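{- Let $G$ be a graph. Then for every $r$-matching $\{f_1,\ldots,f_r\}$ of the subdivision graph $S_G$, the subgraph of $G$ induced by the edge set $\{e(f_1),\ldots,e(f_r)\}$ is a TU-subgraph of $G$.
   Context: All graphs are finite, undirected, without loops or multiple edges. The subdivision graph $S_G$ of $G$ is obtained by inserting into each edge $e=\{u,v\}$ of $G$ a new vertex of degree $2$ (also denoted $e$), replacing $e$ by the two edges $\{e,u\}$ and $\{e,v\}$. For an edge $f$ of $S_G$, $e(f)$ denotes the unique edge of $G$ corresponding to $f$ (i.e. if $f=\{e,u\}$ then $e(f)=e$). An $r$-matching is a set of $r$ pairwise disjoint edges. A TU-subgraph of $G$ is a subgraph each of whose connected components is a tree or a unicyclic graph (connected graph with exactly one cycle). The subgraph induced by an edge set $F$ is the graph with edge set $F$ and vertex set the set of endpoints of edges in $F$. -}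

module Defs where

open import Data.Nat using (ℕ; _+_)
open import Data.Fin using (Fin; _↑ˡ_; _↑ʳ_; splitAt)
open import Data.Fin.Properties using (_≟_)
open import Data.Fin.Subset using (Subset; _∈_; _⊆_; ∣_∣; _∩_; Nonempty)
open import Data.Product using (Σ; ∃; ∃-syntax; _×_; _,_; proj₁; proj₂; swap)
open import Data.Sum using (_⊎_; inj₁; inj₂; [_,_])
open import Data.Bool using (Bool; _∨_)
open import Data.Vec using (tabulate)
open import Function using (id)
open import Relation.Binary.PropositionalEquality using (_≡_; _≢_)
open import Relation.Nullary using (¬_)
open import Relation.Nullary.Decidable using (⌊_⌋)

record Multigraph : Set where
  field
    nV nE : ℕ
    ends : Fin nE → Fin nV × Fin nV

record Graph : Set where
  field
    mg : Multigraph
  open Multigraph mg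
  field
    loopless : ∀ e → proj₁ (ends e) ≢ proj₂ (ends e)
    noMulti  : ∀ e e' → (ends e ≡ ends e' ⊎ ends e ≡ swap (ends e')) → e ≡ e'

module _ (H : Multigraph) where
  open Multigraph H

  Incident : Fin nE → Fin nV → Set
  Incident e v = proj₁ (ends e) ≡ v ⊎ proj₂ (ends e) ≡ v

  incidentᵇ : Fin nE → Fin nV → Bool
  incidentᵇ e v = ⌊ proj₁ (ends e) ≟ v ⌋ ∨ ⌊ proj₂ (ends e) ≟ v ⌋

  VertexOf : Subset nE → Fin nV → Set
  VertexOf C v = ∃[ e ] (e ∈ C × Incident e v)

  deg : Subset nE → Fin nV → ℕ
  deg C v = ∣ C ∩ tabulate (λ e → incidentᵇ e v) ∣

  data Walk (C : Subset nE) : Fin nV → Fin nV → Set where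
    here : ∀ {u} → Walk C u u
    step : ∀ {u w v} (e : Fin nE) → e ∈ C →
           (ends e ≡ (u , w) ⊎ ends e ≡ (w , u)) → Walk C w v → Walk C u v

  Connected : Subset nE → Set
  Connected C = ∀ u v → VertexOf C u → VertexOf C v → Walk C u v

  IsCycle : Subset nE → Set
  IsCycle D = Nonempty D × Connected D × (∀ v → VertexOf D v → deg D v ≡ 2)

  IsTree : Subset nE → Set
  IsTree C = Connected C × (∀ D → D ⊆ C → ¬ IsCycle D)

  IsUnicyclic : Subset nE → Set
  IsUnicyclic C = Connected C ×
    (∃[ D ] (D ⊆ C × IsCycle D × (∀ D' → D' ⊆ C → IsCycle D' → D' ≡ D)))

  -- C is (the edge set of) a connected component of the subgraph induced by F
  -- (every component of an edge-induced subgraph has at least one edge)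
  Component : Subset nE → Subset nE → Set
  Component F C = C ⊆ F × Nonempty C × Connected C ×
    (∀ e e' → e ∈ F → e' ∈ C → (∃[ v ] (Incident e v × Incident e' v)) → e ∈ C)

  IsTU : Subset nE → Set
  IsTU F = ∀ C → Component F C → IsTree C ⊎ IsUnicyclic C

  IsMatching : Subset nE → Set
  IsMatching M = ∀ f f' → f ∈ M → f' ∈ M → f ≢ f' →
    ∀ v → Incident f v → ¬ Incident f' v

  IsRMatching : ℕ → Subset nE → Set
  IsRMatching r M = IsMatching M × ∣ M ∣ ≡ r

-- Subdivision graph S_G: vertices Fin (n + m) (old vertices v ↑ˡ m, new
-- vertices n ↑ʳ e), edges Fin (m + m): e ↑ˡ m = {e, u}, m ↑ʳ e = {e, v}
-- where ends e = (u , v).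
SG : Graph → Multigraph
SG G = record
  { nV = nV + nE
  ; nE = nE + nE
  ; ends = λ f → [ (λ e → (nV ↑ʳ e , proj₁ (ends e) ↑ˡ nE))
                 , (λ e → (nV ↑ʳ e , proj₂ (ends e) ↑ˡ nE)) ] (splitAt nE f)
  }
  where open Multigraph (Graph.mg G)

eOf : (G : Graph) → Fin (Multigraph.nE (Graph.mg G) + Multigraph.nE (Graph.mg G))
      → Fin (Multigraph.nE (Graph.mg G))
eOf G f = [ id , id ] (splitAt (Multigraph.nE (Graph.mg G)) f)

IsImage : (G : Graph) → Subset (Multigraph.nE (SG G)) → Subset (Multigraph.nE (Graph.mg G)) → Set
IsImage G M F = ∀ e → (e ∈ F → ∃[ f ] (f ∈ M × eOf G f ≡ e))
                    × (∃[ f ] (f ∈ M × eOf G f ≡ e) → e ∈ F)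

-- Orient each edge e of F towards the vertex head e where the matching edge at the subdivision
-- vertex e meets G. The matching edges are disjoint, so head is injective on F: every vertex has
-- in-degree at most one. On a cycle D ⊆ F, head maps the edges injectively into the vertices, and an
-- orbit argument shows that every vertex of D is a head; so cycles are closed under the parent map
-- v ↦ tail of the in-edge of v. In a component C, if some vertex r has no in-edge then every vertex
-- of C reaches r under parent, so no cycle can exist (r would lie on it). Otherwise parent is total on
-- C, the edges over a periodic parent-orbit form a cycle, any two cycles meet, and a cycle through a
-- periodic point consists of the edges over its orbit; so C is unicyclic.

module Submission where

open import Defs
open import Data.Bool using (Bool; T)
open import Data.Bool.Properties using (T-≡; T-∨)
open import Data.Fin using (Fin; toℕ; fromℕ<; zero; suc; _↑ˡ_; _↑ʳ_; splitAt)
open import Data.Fin.Properties using (_≟_; any?; pigeonhole; toℕ-fromℕ<; suc-injective)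
open import Data.Fin.Subset using (Subset; _∈_; _⊆_; ∣_∣; _∩_; _∪_; ⁅_⁆; Nonempty; inside; outside)
open import Data.Fin.Subset.Properties
  using (_∈?_; ∩⇔×; ⊆-antisym; x∈p∪q⁺; x∈⁅x⁆; ∣⁅x⁆∣≡1; p⊆q⇒∣p∣≤∣q∣;
         x∈p⇒∣p-x∣<∣p∣; x∈p∧x≢y⇒x∈p-y)
open import Data.Nat using (ℕ; zero; suc; _+_; _∸_; _≤_; _<_; z≤n; s≤s)
open import Data.Nat.Properties
  using (+-comm; +-suc; m∸n+n≡m; n<1+n; ≤-refl; ≤-trans; ≤-reflexive; ≤-antisym; <⇒≢;
         +-monoʳ-≤; m≤n⇒m≤1+n; m≤n⇒m<n∨m≡n)
open import Data.Product using (∃; ∃-syntax; ∃₂; _×_; _,_; proj₁; proj₂)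
import Data.Product as Product
open import Data.Sum using (_⊎_; inj₁; inj₂; [_,_])
import Data.Sum as Sum
open import Data.Vec using ([]; _∷_; here; there; tabulate)
open import Data.Vec.Properties using (lookup∘tabulate; []=⇒lookup; lookup⇒[]=)
open import Function using (_∘_; _⇔_; mk⇔; Equivalence)
open import Relation.Binary.Definitions using (DecidableEquality)
open import Relation.Binary.PropositionalEquality
  using (_≡_; _≢_; refl; sym; trans; cong; cong₂; cong-app; subst; subst₂; module ≡-Reasoning)
open import Relation.Nullary using (¬_; Dec; yes; no; contradiction)
open import Relation.Nullary.Decidable using (⌊_⌋; _×-dec_; _⊎-dec_; ¬?; map′; fromWitness; toWitness)
open import Relation.Unary using (Decidable)

private variable
  n : ℕ
  p : Subset n
  x y z : Fin n

-- Iterates and periodic orbits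

module Iterate {A : Set} (f : A → A) where
  open import Function.Endo.Propositional A using (_^_; ^-homo)

  ^-+ : ∀ k l a → (f ^ (k + l)) a ≡ (f ^ k) ((f ^ l) a)
  ^-+ k l a = cong-app (^-homo f k l) a

  ^-suc′ : ∀ k a → (f ^ suc k) a ≡ (f ^ k) (f a)
  ^-suc′ k a = trans (cong (λ l → (f ^ l) a) (+-comm 1 k)) (^-+ k 1 a)

  ^-preserves : (P : A → Set) → (∀ {a} → P a → P (f a)) → ∀ k {a} → P a → P ((f ^ k) a)
  ^-preserves P f-preserves zero    Pa = Pa
  ^-preserves P f-preserves (suc k) Pa = f-preserves (^-preserves P f-preserves k Pa)

  module Periodic (c : A) (m : ℕ) (period : (f ^ suc m) c ≡ c) where

    Orbit : A → Set
    Orbit a = ∃[ k ] (f ^ k) c ≡ a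

    orbit-start : Orbit c
    orbit-start = 0 , refl

    orbit-step : ∀ {a} → Orbit a → Orbit (f a)
    orbit-step (k , eq) = suc k , cong f eq

    orbit-⊆ : (P : A → Set) → (∀ {a} → P a → P (f a)) → P c → ∀ {a} → Orbit a → P a
    orbit-⊆ P f-preserves Pc (k , refl) = ^-preserves P f-preserves k Pc

    orbit-periodic : ∀ {a} → Orbit a → (f ^ suc m) a ≡ a
    orbit-periodic (k , refl) = begin
      (f ^ suc m) ((f ^ k) c) ≡⟨ ^-+ (suc m) k c ⟨
      (f ^ (suc m + k)) c     ≡⟨ cong (λ l → (f ^ l) c) (+-comm (suc m) k) ⟩
      (f ^ (k + suc m)) c     ≡⟨ ^-+ k (suc m) c ⟩
      (f ^ k) ((f ^ suc m) c) ≡⟨ cong (f ^ k) period ⟩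
      (f ^ k) c               ∎
      where open ≡-Reasoning

    orbit-pred : ∀ {a} → Orbit a → ∃[ b ] (Orbit b × f b ≡ a)
    orbit-pred {a} o@(k , eq) =
      (f ^ m) a , (m + k , trans (^-+ m k c) (cong (f ^ m) eq)) , orbit-periodic o

    orbit-injective : ∀ {a b} → Orbit a → Orbit b → f a ≡ f b → a ≡ b
    orbit-injective {a} {b} oa ob fa≡fb = begin
      a                 ≡⟨ orbit-periodic oa ⟨
      (f ^ suc m) a     ≡⟨ ^-suc′ m a ⟩
      (f ^ m) (f a)     ≡⟨ cong (f ^ m) fa≡fb ⟩
      (f ^ m) (f b)     ≡⟨ ^-suc′ m b ⟨
      (f ^ suc m) b     ≡⟨ orbit-periodic ob ⟩
      b                 ∎
      where open ≡-Reasoning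

    orbit-within-period : ∀ k → ∃[ j ] (j < suc m × (f ^ j) c ≡ (f ^ k) c)
    orbit-within-period zero = 0 , s≤s z≤n , refl
    orbit-within-period (suc k) with orbit-within-period k
    ... | j , s≤s j≤m , eq with m≤n⇒m<n∨m≡n j≤m
    ... | inj₁ j<m  = suc j , s≤s j<m , cong f eq
    ... | inj₂ refl = 0 , s≤s z≤n , trans (sym period) (cong f eq)

    orbit? : DecidableEquality A → ∀ a → Dec (Orbit a)
    orbit? _≟ᴬ_ a = map′ (λ (k , eq) → toℕ k , eq) bounded (any? λ k → (f ^ toℕ k) c ≟ᴬ a)
      where
      bounded : Orbit a → ∃[ k ] (f ^ toℕ {suc m} k) c ≡ a
      bounded (k , refl) with orbit-within-period k
      ... | j , j<1+m , eq = fromℕ< j<1+m , trans (cong (λ l → (f ^ l) c) (toℕ-fromℕ< j<1+m)) eq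

module _ (f : Fin n → Fin n) where
  open Iterate f
  open import Function.Endo.Propositional (Fin n) using (_^_)

  eventually-periodic : ∀ a → ∃₂ λ i m → (f ^ suc m) ((f ^ i) a) ≡ (f ^ i) a
  eventually-periodic a with pigeonhole (n<1+n n) (λ k → (f ^ toℕ k) a)
  ... | i , j , i<j , fⁱa≡fʲa = toℕ i , d , (begin
    (f ^ suc d) ((f ^ toℕ i) a) ≡⟨ ^-+ (suc d) (toℕ i) a ⟨
    (f ^ (suc d + toℕ i)) a     ≡⟨ cong (λ l → (f ^ l) a) (trans (sym (+-suc d (toℕ i))) (m∸n+n≡m i<j)) ⟩
    (f ^ toℕ j) a               ≡⟨ fⁱa≡fʲa ⟨
    (f ^ toℕ i) a               ∎)
    where
    open ≡-Reasoning
    d = toℕ j ∸ suc (toℕ i)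

-- Counting elements of finite subsets

x∈p⇒1≤∣p∣ : x ∈ p → 1 ≤ ∣ p ∣
x∈p⇒1≤∣p∣ x∈p = ≤-trans (s≤s z≤n) (x∈p⇒∣p-x∣<∣p∣ x∈p)

distinct₂⇒2≤∣p∣ : x ∈ p → y ∈ p → x ≢ y → 2 ≤ ∣ p ∣
distinct₂⇒2≤∣p∣ x∈p y∈p x≢y =
  ≤-trans (s≤s (x∈p⇒1≤∣p∣ (x∈p∧x≢y⇒x∈p-y y∈p (x≢y ∘ sym)))) (x∈p⇒∣p-x∣<∣p∣ x∈p)

distinct₃⇒3≤∣p∣ : x ∈ p → y ∈ p → z ∈ p → x ≢ y → x ≢ z → y ≢ z → 3 ≤ ∣ p ∣
distinct₃⇒3≤∣p∣ x∈p y∈p z∈p x≢y x≢z y≢z =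
  ≤-trans (s≤s (distinct₂⇒2≤∣p∣ (x∈p∧x≢y⇒x∈p-y y∈p (x≢y ∘ sym))
                                (x∈p∧x≢y⇒x∈p-y z∈p (x≢z ∘ sym)) y≢z))
          (x∈p⇒∣p-x∣<∣p∣ x∈p)

1≤∣p∣⇒nonempty : ∀ (p : Subset n) → 1 ≤ ∣ p ∣ → Nonempty p
1≤∣p∣⇒nonempty (inside  ∷ p) _   = zero , here
1≤∣p∣⇒nonempty (outside ∷ p) 1≤∣p∣ with 1≤∣p∣⇒nonempty p 1≤∣p∣
... | x , x∈p = suc x , there x∈p

2≤∣p∣⇒distinct₂ : ∀ (p : Subset n) → 2 ≤ ∣ p ∣ → ∃₂ λ x y → x ≢ y × x ∈ p × y ∈ p
2≤∣p∣⇒distinct₂ (inside ∷ p) (s≤s 1≤∣p∣) with 1≤∣p∣⇒nonempty p 1≤∣p∣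
... | y , y∈p = zero , suc y , (λ ()) , here , there y∈p
2≤∣p∣⇒distinct₂ (outside ∷ p) 2≤∣p∣ with 2≤∣p∣⇒distinct₂ p 2≤∣p∣
... | x , y , x≢y , x∈p , y∈p = suc x , suc y , x≢y ∘ suc-injective , there x∈p , there y∈p

∣p∪q∣≤∣p∣+∣q∣ : ∀ (p q : Subset n) → ∣ p ∪ q ∣ ≤ ∣ p ∣ + ∣ q ∣
∣p∪q∣≤∣p∣+∣q∣ []            []            = z≤n
∣p∪q∣≤∣p∣+∣q∣ (outside ∷ p) (outside ∷ q) = ∣p∪q∣≤∣p∣+∣q∣ p q
∣p∪q∣≤∣p∣+∣q∣ (outside ∷ p) (inside  ∷ q) =
  ≤-trans (s≤s (∣p∪q∣≤∣p∣+∣q∣ p q)) (≤-reflexive (sym (+-suc ∣ p ∣ ∣ q ∣)))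
∣p∪q∣≤∣p∣+∣q∣ (inside  ∷ p) (outside ∷ q) = s≤s (∣p∪q∣≤∣p∣+∣q∣ p q)
∣p∪q∣≤∣p∣+∣q∣ (inside  ∷ p) (inside  ∷ q) =
  s≤s (≤-trans (∣p∪q∣≤∣p∣+∣q∣ p q) (+-monoʳ-≤ ∣ p ∣ (m≤n⇒m≤1+n ≤-refl)))

⊆⁅x,y⁆⇒∣p∣≤2 : (∀ z → z ∈ p → z ≡ x ⊎ z ≡ y) → ∣ p ∣ ≤ 2
⊆⁅x,y⁆⇒∣p∣≤2 {p = p} {x = x} {y = y} ⊆xy = begin
  ∣ p ∣                 ≤⟨ p⊆q⇒∣p∣≤∣q∣ p⊆⁅x⁆∪⁅y⁆ ⟩
  ∣ ⁅ x ⁆ ∪ ⁅ y ⁆ ∣     ≤⟨ ∣p∪q∣≤∣p∣+∣q∣ ⁅ x ⁆ ⁅ y ⁆ ⟩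
  ∣ ⁅ x ⁆ ∣ + ∣ ⁅ y ⁆ ∣ ≡⟨ cong₂ _+_ (∣⁅x⁆∣≡1 x) (∣⁅x⁆∣≡1 y) ⟩
  2                     ∎
  where
  open Data.Nat.Properties.≤-Reasoning
  p⊆⁅x⁆∪⁅y⁆ : p ⊆ ⁅ x ⁆ ∪ ⁅ y ⁆
  p⊆⁅x⁆∪⁅y⁆ {z} z∈p with ⊆xy z z∈p
  ... | inj₁ refl = x∈p∪q⁺ (inj₁ (x∈⁅x⁆ z))
  ... | inj₂ refl = x∈p∪q⁺ (inj₂ (x∈⁅x⁆ z))

∣p∣≡2⇒⊆⁅x,y⁆ : ∣ p ∣ ≡ 2 → x ∈ p → y ∈ p → x ≢ y → z ∈ p → z ≡ x ⊎ z ≡ y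
∣p∣≡2⇒⊆⁅x,y⁆ {x = x} {y = y} {z = z} ∣p∣≡2 x∈p y∈p x≢y z∈p with z ≟ x | z ≟ y
... | yes z≡x | _       = inj₁ z≡x
... | no _    | yes z≡y = inj₂ z≡y
... | no z≢x  | no z≢y  =
  contradiction (sym ∣p∣≡2) (<⇒≢ (distinct₃⇒3≤∣p∣ x∈p y∈p z∈p x≢y (z≢x ∘ sym) (z≢y ∘ sym)))

⊆⁅x,y⁆⇒∣p∣≡2 : x ∈ p → y ∈ p → x ≢ y → (∀ z → z ∈ p → z ≡ x ⊎ z ≡ y) → ∣ p ∣ ≡ 2
⊆⁅x,y⁆⇒∣p∣≡2 x∈p y∈p x≢y ⊆xy =
  ≤-antisym (⊆⁅x,y⁆⇒∣p∣≤2 ⊆xy) (distinct₂⇒2≤∣p∣ x∈p y∈p x≢y)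

∈-tabulate : ∀ {g : Fin n → Bool} → x ∈ tabulate g ⇔ T (g x)
∈-tabulate {x = x} {g = g} = mk⇔
  (λ x∈ → Equivalence.from T-≡ (trans (sym (lookup∘tabulate g x)) ([]=⇒lookup x∈)))
  (λ Tgx → lookup⇒[]= x _ (trans (lookup∘tabulate g x) (Equivalence.to T-≡ Tgx)))

select : {P : Fin n → Set} → Decidable P → Subset n
select P? = tabulate (⌊_⌋ ∘ P?)

∈-select : {P : Fin n → Set} (P? : Decidable P) → x ∈ select P? ⇔ P x
∈-select P? = mk⇔
  (toWitness ∘ Equivalence.to ∈-tabulate)
  (Equivalence.from ∈-tabulate ∘ fromWitness)

-- Walks, degrees and cycles

module MultigraphProperties (H : Multigraph) where
  open Multigraph H
  open import Function.Endo.Propositional (Fin nV) using (_^_)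

  private variable
    e a b : Fin nE
    u v w w′ : Fin nV
    X D : Subset nE

  Joins : Fin nE → Fin nV → Fin nV → Set
  Joins e u w = ends e ≡ (u , w) ⊎ ends e ≡ (w , u)

  joins-sym : Joins e u w → Joins e w u
  joins-sym (inj₁ eq) = inj₂ eq
  joins-sym (inj₂ eq) = inj₁ eq

  joins⇒incident : Joins e u w → Incident H e u
  joins⇒incident (inj₁ eq) = inj₁ (cong proj₁ eq)
  joins⇒incident (inj₂ eq) = inj₂ (cong proj₂ eq)

  joins-incident : Joins e u w → Incident H e v → v ≡ u ⊎ v ≡ w
  joins-incident (inj₁ eq) (inj₁ i) = inj₁ (trans (sym i) (cong proj₁ eq))
  joins-incident (inj₁ eq) (inj₂ i) = inj₂ (trans (sym i) (cong proj₂ eq))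
  joins-incident (inj₂ eq) (inj₁ i) = inj₂ (trans (sym i) (cong proj₁ eq))
  joins-incident (inj₂ eq) (inj₂ i) = inj₁ (trans (sym i) (cong proj₂ eq))

  joins-unique : Joins e u w → Joins e u w′ → w ≡ w′
  joins-unique (inj₁ eq) (inj₁ eq′) = cong proj₂ (trans (sym eq) eq′)
  joins-unique (inj₁ eq) (inj₂ eq′) = let uw≡w′u = trans (sym eq) eq′ in
    trans (cong proj₂ uw≡w′u) (cong proj₁ uw≡w′u)
  joins-unique (inj₂ eq) (inj₁ eq′) = let wu≡uw′ = trans (sym eq) eq′ in
    trans (cong proj₁ wu≡uw′) (cong proj₂ wu≡uw′)
  joins-unique (inj₂ eq) (inj₂ eq′) = cong proj₁ (trans (sym eq) eq′)

  walk-preserves : (P : Fin nV → Set) → (∀ {e u w} → e ∈ X → Joins e u w → P u → P w) →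
                   Walk H X u v → P u → P v
  walk-preserves P preserve here              Pu = Pu
  walk-preserves P preserve (step e e∈X j ws) Pu = walk-preserves P preserve ws (preserve e∈X j Pu)

  _++ʷ_ : Walk H X u v → Walk H X v w → Walk H X u w
  here             ++ʷ ws′ = ws′
  step e e∈X j ws ++ʷ ws′ = step e e∈X j (ws ++ʷ ws′)

  reverseʷ : Walk H X u v → Walk H X v u
  reverseʷ here              = here
  reverseʷ (step e e∈X j ws) = reverseʷ ws ++ʷ step e e∈X (joins-sym j) here

  incident? : ∀ e v → Dec (Incident H e v)
  incident? e v = (proj₁ (ends e) ≟ v) ⊎-dec (proj₂ (ends e) ≟ v)

  vertexOf? : ∀ X v → Dec (VertexOf H X v)
  vertexOf? X v = any? λ e → (e ∈? X) ×-dec incident? e v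

  -- deg H X v ≡ ∣ edgesAt X v ∣ holds definitionally.
  edgesAt : Subset nE → Fin nV → Subset nE
  edgesAt X v = X ∩ tabulate (λ e → incidentᵇ H e v)

  T-incidentᵇ : T (incidentᵇ H e v) ⇔ Incident H e v
  T-incidentᵇ {e} {v} = mk⇔
    (Sum.map (toWitness {a? = ends₁≟v}) (toWitness {a? = ends₂≟v}) ∘ Equivalence.to (T-∨ {⌊ ends₁≟v ⌋}))
    (Equivalence.from (T-∨ {⌊ ends₁≟v ⌋}) ∘ Sum.map (fromWitness {a? = ends₁≟v}) (fromWitness {a? = ends₂≟v}))
    where
    ends₁≟v = proj₁ (ends e) ≟ v
    ends₂≟v = proj₂ (ends e) ≟ v

  ∈-edgesAt : e ∈ edgesAt X v ⇔ (e ∈ X × Incident H e v)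
  ∈-edgesAt = mk⇔
    (Product.map₂ (Equivalence.to T-incidentᵇ ∘ Equivalence.to ∈-tabulate) ∘ Equivalence.to ∩⇔×)
    (Equivalence.from ∩⇔× ∘ Product.map₂ (Equivalence.from ∈-tabulate ∘ Equivalence.from T-incidentᵇ))

  deg≡2⇒two-edges : deg H X v ≡ 2 →
                    ∃₂ λ a b → a ≢ b × (a ∈ X × Incident H a v) × (b ∈ X × Incident H b v)
  deg≡2⇒two-edges {X} {v} d≡2 with 2≤∣p∣⇒distinct₂ (edgesAt X v) (≤-reflexive (sym d≡2))
  ... | a , b , a≢b , a∈ , b∈ = a , b , a≢b , Equivalence.to ∈-edgesAt a∈ , Equivalence.to ∈-edgesAt b∈

  deg≡2⇒only-two : deg H X v ≡ 2 → a ∈ X → Incident H a v → b ∈ X → Incident H b v → a ≢ b →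
                   e ∈ X → Incident H e v → e ≡ a ⊎ e ≡ b
  deg≡2⇒only-two d≡2 a∈X ia b∈X ib a≢b e∈X ie = ∣p∣≡2⇒⊆⁅x,y⁆ d≡2
    (Equivalence.from ∈-edgesAt (a∈X , ia)) (Equivalence.from ∈-edgesAt (b∈X , ib)) a≢b
    (Equivalence.from ∈-edgesAt (e∈X , ie))

  only-two⇒deg≡2 : a ∈ X → Incident H a v → b ∈ X → Incident H b v → a ≢ b →
                   (∀ e → e ∈ X → Incident H e v → e ≡ a ⊎ e ≡ b) → deg H X v ≡ 2
  only-two⇒deg≡2 a∈X ia b∈X ib a≢b only = ⊆⁅x,y⁆⇒∣p∣≡2
    (Equivalence.from ∈-edgesAt (a∈X , ia)) (Equivalence.from ∈-edgesAt (b∈X , ib)) a≢b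
    (λ e e∈ → let e∈X , ie = Equivalence.to ∈-edgesAt e∈ in only e e∈X ie)

  nonempty⇒vertex : Nonempty X → ∃ (VertexOf H X)
  nonempty⇒vertex (e , e∈X) = proj₁ (ends e) , e , e∈X , inj₁ refl

  cycle-neighbours : IsCycle H D → a ∈ D → Joins a u v → b ∈ D → Joins b u w′ → a ≢ b →
                     e ∈ D → Joins e u w → w ≡ v ⊎ w ≡ w′
  cycle-neighbours {u = u} (_ , _ , 2-regular) a∈D ja b∈D jb a≢b e∈D je
    with deg≡2⇒only-two (2-regular u (_ , a∈D , joins⇒incident ja))
           a∈D (joins⇒incident ja) b∈D (joins⇒incident jb) a≢b e∈D (joins⇒incident je)
  ... | inj₁ refl = inj₁ (joins-unique je ja)
  ... | inj₂ refl = inj₂ (joins-unique je jb)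

  -- Every orbit point x is joined to g x by a cycle edge, tagged by s so that different points use
  -- different edges. The two cycle edges at an orbit point therefore both lead back into the orbit,
  -- and connectivity of the cycle does the rest.
  orbit-covers-cycle : IsCycle H D → (g : Fin nV → Fin nV) (c : Fin nV) (m : ℕ)
    (period : (g ^ suc m) c ≡ c) → let open Iterate.Periodic g c m period in
    (s : Fin nE → Fin nV) →
    (∀ {x} → Orbit x → ∃[ e ] (e ∈ D × s e ≡ x × Joins e x (g x))) →
    (∀ {x} → Orbit x → g x ≢ x) →
    ∀ {v} → VertexOf H D v → Orbit v
  orbit-covers-cycle {D} cycle@(_ , connected , _) g c m period s arc g-moves vD =
    walk-preserves Orbit closed (connected c _ cD vD) orbit-start
    where
    open Iterate.Periodic g c m period
    cD : VertexOf H D c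
    cD = let e , e∈D , _ , j = arc orbit-start in e , e∈D , joins⇒incident j
    closed : ∀ {e u w} → e ∈ D → Joins e u w → Orbit u → Orbit w
    closed e∈D j ou with arc ou | orbit-pred ou
    ... | a , a∈D , sa≡u , ja | y , oy , gy≡u with arc oy
    ... | b , b∈D , sb≡y , jb
      with cycle-neighbours cycle a∈D ja b∈D (joins-sym (subst (Joins b y) gy≡u jb))
             (λ { refl → g-moves ou (trans (cong g (trans (sym sa≡u) sb≡y)) gy≡u) }) e∈D j
    ... | inj₁ refl = orbit-step ou
    ... | inj₂ refl = oy

-- Edge sets with injective heads

module InjectiveHeads (H : Multigraph)
  (loopless : ∀ e → proj₁ (Multigraph.ends H e) ≢ proj₂ (Multigraph.ends H e))
  (F : Subset (Multigraph.nE H)) (head : Fin (Multigraph.nE H) → Fin (Multigraph.nV H))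
  (head-incident : ∀ {e} → e ∈ F → Incident H e (head e))
  (head-injective : ∀ {e e′} → e ∈ F → e′ ∈ F → head e ≡ head e′ → e ≡ e′) where
  open Multigraph H
  open MultigraphProperties H
  open import Function.Endo.Propositional (Fin nV) using (_^_)

  private variable
    e : Fin nE
    u v w r : Fin nV
    C D D′ : Subset nE

  tail : Fin nE → Fin nV
  tail e with proj₁ (ends e) ≟ head e
  ... | yes _ = proj₂ (ends e)
  ... | no _  = proj₁ (ends e)

  joins-tail-head : e ∈ F → Joins e (tail e) (head e)
  joins-tail-head {e} e∈F with proj₁ (ends e) ≟ head e | head-incident e∈F
  ... | yes end₁≡head | _               = inj₂ (cong (_, proj₂ (ends e)) end₁≡head)
  ... | no end₁≢head  | inj₁ end₁≡head = contradiction end₁≡head end₁≢head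
  ... | no _          | inj₂ end₂≡head = inj₁ (cong (proj₁ (ends e) ,_) end₂≡head)

  tail≢head : e ∈ F → tail e ≢ head e
  tail≢head {e} e∈F t≡h with joins-tail-head e∈F
  ... | inj₁ eq = loopless e (trans (cong proj₁ eq) (trans t≡h (sym (cong proj₂ eq))))
  ... | inj₂ eq = loopless e (trans (cong proj₁ eq) (trans (sym t≡h) (sym (cong proj₂ eq))))

  tail-incident : e ∈ F → Incident H e (tail e)
  tail-incident e∈F = joins⇒incident (joins-tail-head e∈F)

  incident⇒tail⊎head : e ∈ F → Incident H e v → v ≡ tail e ⊎ v ≡ head e
  incident⇒tail⊎head e∈F = joins-incident (joins-tail-head e∈F)

  joins⇒head : e ∈ F → Joins e u w → head e ≡ u ⊎ head e ≡ w
  joins⇒head e∈F j = joins-incident j (head-incident e∈F)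

  joins-head⇒tail : e ∈ F → Joins e u w → head e ≡ u → tail e ≡ w
  joins-head⇒tail e∈F j refl = joins-unique (joins-sym (joins-tail-head e∈F)) j

  HasInEdge : Subset nE → Fin nV → Set
  HasInEdge X v = ∃[ e ] (e ∈ X × head e ≡ v)

  inEdge-⊆ : ∀ {X Y} → X ⊆ Y → HasInEdge X v → HasInEdge Y v
  inEdge-⊆ X⊆Y (e , e∈X , h≡v) = e , X⊆Y e∈X , h≡v

  hasInEdge? : ∀ X v → Dec (HasInEdge X v)
  hasInEdge? X v = any? λ e → (e ∈? X) ×-dec (head e ≟ v)

  parent : Fin nV → Fin nV
  parent v with hasInEdge? F v
  ... | yes (e , _) = tail e
  ... | no _        = v

  parent-head : e ∈ F → parent (head e) ≡ tail e
  parent-head {e} e∈F with hasInEdge? F (head e)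
  ... | yes (e′ , e′∈F , head≡) = cong tail (head-injective e′∈F e∈F head≡)
  ... | no ¬in                  = contradiction (e , e∈F , refl) ¬in

  joins-parent-of-head : e ∈ F → head e ≡ v → Joins e v (parent v)
  joins-parent-of-head e∈F refl = subst (Joins _ _) (sym (parent-head e∈F)) (joins-sym (joins-tail-head e∈F))

  joins-parent : e ∈ F → Joins e u w → head e ≡ u → parent u ≡ w
  joins-parent e∈F j h≡u = joins-unique (joins-parent-of-head e∈F h≡u) j

  parent-moves : HasInEdge F v → parent v ≢ v
  parent-moves (e , e∈F , h≡v) pv≡v =
    tail≢head e∈F (trans (sym (parent-head e∈F)) (trans (cong parent h≡v) (trans pv≡v (sym h≡v))))

  inEdge⇒parent-vertex : ∀ {X} → X ⊆ F → HasInEdge X v → VertexOf H X (parent v)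
  inEdge⇒parent-vertex X⊆F (e , e∈X , h≡v) =
    e , e∈X , joins⇒incident (joins-sym (joins-parent-of-head (X⊆F e∈X) h≡v))

  inEdge-of-head : ∀ {X} → X ⊆ F → e ∈ F → HasInEdge X (head e) → e ∈ X
  inEdge-of-head {X = X} X⊆F e∈F (e′ , e′∈X , h≡h) =
    subst (_∈ X) (head-injective (X⊆F e′∈X) e∈F h≡h) e′∈X

  open Iterate parent using (^-suc′; ^-preserves)

  incident-not-head⇒tail : e ∈ F → Incident H e v → head e ≢ v → tail e ≡ v
  incident-not-head⇒tail e∈F i h≢v with incident⇒tail⊎head e∈F i
  ... | inj₁ v≡t = sym v≡t
  ... | inj₂ v≡h = contradiction (sym v≡h) h≢v

  cycle-outEdge : D ⊆ F → IsCycle H D → VertexOf H D v → ∃[ e ] (e ∈ D × tail e ≡ v)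
  cycle-outEdge {v = v} D⊆F (_ , _ , 2-regular) vD with deg≡2⇒two-edges (2-regular v vD)
  ... | a , b , a≢b , (a∈D , ia) , (b∈D , ib) with head a ≟ v | head b ≟ v
  ... | no ha≢v  | _        = a , a∈D , incident-not-head⇒tail (D⊆F a∈D) ia ha≢v
  ... | yes ha≡v | yes hb≡v = contradiction (head-injective (D⊆F a∈D) (D⊆F b∈D) (trans ha≡v (sym hb≡v))) a≢b
  ... | yes _    | no hb≢v  = b , b∈D , incident-not-head⇒tail (D⊆F b∈D) ib hb≢v

  module _ (D⊆F : D ⊆ F) (cycle : IsCycle H D) where
    private
      child : Fin nV → Fin nV
      child v with any? (λ e → (e ∈? D) ×-dec (tail e ≟ v))
      ... | yes (e , _) = head e
      ... | no _        = v

      child-edge : VertexOf H D v → ∃[ e ] (e ∈ D × tail e ≡ v × head e ≡ child v)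
      child-edge {v} vD with any? (λ e → (e ∈? D) ×-dec (tail e ≟ v))
      ... | yes (e , e∈D , t≡v) = e , e∈D , t≡v , refl
      ... | no ¬out             = contradiction (cycle-outEdge D⊆F cycle vD) ¬out

      child-vertex : VertexOf H D v → VertexOf H D (child v)
      child-vertex vD with child-edge vD
      ... | e , e∈D , _ , h≡cv = e , e∈D , subst (Incident H e) h≡cv (head-incident (D⊆F e∈D))

    -- Each vertex of D has an out-edge in D (degree 2, at most one in-edge). Following out-edges ends in
    -- a periodic orbit, which covers D; every orbit point is the head of its predecessor's out-edge.
    cycle-inEdge : VertexOf H D v → HasInEdge D v
    cycle-inEdge {v} vD with eventually-periodic child v
    ... | i , m , period = in-edge (orbit-covers-cycle cycle child ((child ^ i) v) m period tail arc moves vD)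
      where
      open Iterate.Periodic child ((child ^ i) v) m period
      orbit⊆D : ∀ {x} → Orbit x → VertexOf H D x
      orbit⊆D = orbit-⊆ (VertexOf H D) child-vertex (Iterate.^-preserves child (VertexOf H D) child-vertex i vD)
      arc : ∀ {x} → Orbit x → ∃[ e ] (e ∈ D × tail e ≡ x × Joins e x (child x))
      arc ox with child-edge (orbit⊆D ox)
      ... | e , e∈D , t≡x , h≡cx = e , e∈D , t≡x , subst₂ (Joins e) t≡x h≡cx (joins-tail-head (D⊆F e∈D))
      moves : ∀ {x} → Orbit x → child x ≢ x
      moves ox cx≡x with child-edge (orbit⊆D ox)
      ... | e , e∈D , t≡x , h≡cx = tail≢head (D⊆F e∈D) (trans t≡x (sym (trans h≡cx cx≡x)))
      in-edge : Orbit v → HasInEdge D v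
      in-edge ov with orbit-pred ov
      ... | y , oy , cy≡v with child-edge (orbit⊆D oy)
      ... | e , e∈D , _ , h≡cy = e , e∈D , trans h≡cy cy≡v

    cycle-parent-closed : VertexOf H D v → VertexOf H D (parent v)
    cycle-parent-closed = inEdge⇒parent-vertex D⊆F ∘ cycle-inEdge

  module _ (C⊆F : C ⊆ F) (connected : Connected H C) where

    reaches : (P : Fin nV → Set) → (∀ {e} → e ∈ C → P (head e) → P (tail e)) →
              VertexOf H C u → P u → VertexOf H C v → ∃[ k ] P ((parent ^ k) v)
    reaches P head⇒tail uC Pu vC =
      walk-preserves (λ w → ∃[ k ] P ((parent ^ k) w)) closed (connected _ _ uC vC) (0 , Pu)
      where
      closed : ∀ {e u w} → e ∈ C → Joins e u w → ∃[ k ] P ((parent ^ k) u) → ∃[ k ] P ((parent ^ k) w)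
      closed {e} {u} {w} e∈C j (k , Pk) with joins⇒head (C⊆F e∈C) j
      ... | inj₂ h≡w = suc k ,
        subst P (sym (trans (^-suc′ k w) (cong (parent ^ k) (joins-parent (C⊆F e∈C) (joins-sym j) h≡w)))) Pk
      ... | inj₁ h≡u with k
      ...   | zero    = 0 , subst P (joins-head⇒tail (C⊆F e∈C) j h≡u) (head⇒tail e∈C (subst P (sym h≡u) Pk))
      ...   | suc k′ = k′ ,
        subst P (trans (^-suc′ k′ u) (cong (parent ^ k′) (joins-parent (C⊆F e∈C) j h≡u))) Pk

    vertex-⊆ : D ⊆ C → VertexOf H D v → VertexOf H C v
    vertex-⊆ D⊆C (e , e∈D , i) = e , D⊆C e∈D , i

    source⇒acyclic : VertexOf H C r → ¬ HasInEdge C r → D ⊆ C → ¬ IsCycle H D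
    source⇒acyclic {r} {D} rC no-in D⊆C cycle =
      no-inEdge-in-D (cycle-inEdge D⊆F cycle (reached (nonempty⇒vertex (proj₁ cycle))))
      where
      D⊆F : D ⊆ F
      D⊆F = C⊆F ∘ D⊆C
      reached : ∃ (VertexOf H D) → VertexOf H D r
      reached (x , xD)
        with reaches (_≡ r) (λ e∈C h≡r → contradiction (_ , e∈C , h≡r) no-in) rC refl (vertex-⊆ D⊆C xD)
      ... | k , pᵏx≡r = subst (VertexOf H D) pᵏx≡r (^-preserves (VertexOf H D) (cycle-parent-closed D⊆F cycle) k xD)
      no-inEdge-in-D : ¬ HasInEdge D r
      no-inEdge-in-D (e , e∈D , h≡r) = no-in (e , D⊆C e∈D , h≡r)

    cycles-meet : D ⊆ C → IsCycle H D → D′ ⊆ C → IsCycle H D′ → ∃[ x ] (VertexOf H D x × VertexOf H D′ x)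
    cycles-meet {D} {D′} D⊆C cycle D′⊆C cycle′ =
      meet (nonempty⇒vertex (proj₁ cycle)) (nonempty⇒vertex (proj₁ cycle′))
      where
      head⇒tail : ∀ {e} → e ∈ C → VertexOf H D′ (head e) → VertexOf H D′ (tail e)
      head⇒tail {e} e∈C hD′ =
        e , inEdge-of-head (C⊆F ∘ D′⊆C) (C⊆F e∈C) (cycle-inEdge (C⊆F ∘ D′⊆C) cycle′ hD′) ,
        tail-incident (C⊆F e∈C)
      meet : ∃ (VertexOf H D) → ∃ (VertexOf H D′) → ∃[ x ] (VertexOf H D x × VertexOf H D′ x)
      meet (x , xD) (y , yD′) = Product.map (λ k → (parent ^ k) x)
        (λ {k} pᵏxD′ → ^-preserves (VertexOf H D) (cycle-parent-closed (C⊆F ∘ D⊆C) cycle) k xD , pᵏxD′)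
        (reaches (VertexOf H D′) head⇒tail (vertex-⊆ D′⊆C yD′) yD′ (vertex-⊆ D⊆C xD))

    -- Both cycles are closed under parent, so the parent-orbit of a common point lies in D′; it covers D.
    cycle-vertices-⊆ : D ⊆ C → IsCycle H D → D′ ⊆ C → IsCycle H D′ → VertexOf H D v → VertexOf H D′ v
    cycle-vertices-⊆ {D} {D′} {v} D⊆C cycle D′⊆C cycle′ vD = from-meet (cycles-meet D⊆C cycle D′⊆C cycle′)
      where
      from-meet : ∃[ x ] (VertexOf H D x × VertexOf H D′ x) → VertexOf H D′ v
      from-meet (x , xD , xD′) with eventually-periodic parent x
      ... | i , m , period =
        orbit⊆ D′⊆C cycle′ xD′ (orbit-covers-cycle cycle parent ((parent ^ i) x) m period head arc moves vD)
        where
        open Iterate.Periodic parent ((parent ^ i) x) m period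
        orbit⊆ : ∀ {X} → X ⊆ C → IsCycle H X → VertexOf H X x → ∀ {y} → Orbit y → VertexOf H X y
        orbit⊆ {X} X⊆C cycleX xX = orbit-⊆ (VertexOf H X) (cycle-parent-closed (C⊆F ∘ X⊆C) cycleX)
                                     (^-preserves (VertexOf H X) (cycle-parent-closed (C⊆F ∘ X⊆C) cycleX) i xX)
        arc-of : ∀ {y} → HasInEdge D y → ∃[ e ] (e ∈ D × head e ≡ y × Joins e y (parent y))
        arc-of (e , e∈D , h≡y) = e , e∈D , h≡y , joins-parent-of-head (C⊆F (D⊆C e∈D)) h≡y
        in-edge : ∀ {y} → Orbit y → HasInEdge D y
        in-edge oy = cycle-inEdge (C⊆F ∘ D⊆C) cycle (orbit⊆ D⊆C cycle xD oy)
        arc : ∀ {y} → Orbit y → ∃[ e ] (e ∈ D × head e ≡ y × Joins e y (parent y))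
        arc = arc-of ∘ in-edge
        moves : ∀ {y} → Orbit y → parent y ≢ y
        moves = parent-moves ∘ inEdge-⊆ (C⊆F ∘ D⊆C) ∘ in-edge

    cycle-⊆ : D ⊆ C → IsCycle H D → D′ ⊆ C → IsCycle H D′ → D ⊆ D′
    cycle-⊆ {D} {D′} D⊆C cycle D′⊆C cycle′ {e} e∈D =
      inEdge-of-head (C⊆F ∘ D′⊆C) (C⊆F (D⊆C e∈D)) (cycle-inEdge (C⊆F ∘ D′⊆C) cycle′
        (cycle-vertices-⊆ D⊆C cycle D′⊆C cycle′ (e , e∈D , head-incident (C⊆F (D⊆C e∈D)))))

    unique-cycle : D ⊆ C → IsCycle H D → D′ ⊆ C → IsCycle H D′ → D′ ≡ D
    unique-cycle D⊆C cycle D′⊆C cycle′ =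
      ⊆-antisym (cycle-⊆ D′⊆C cycle′ D⊆C cycle) (cycle-⊆ D⊆C cycle D′⊆C cycle′)

    module _ (in-edges : ∀ {v} → VertexOf H C v → HasInEdge C v) where

      parent-vertex : VertexOf H C v → VertexOf H C (parent v)
      parent-vertex = inEdge⇒parent-vertex C⊆F ∘ in-edges

      module OrbitCycle (c : Fin nV) (m : ℕ) (period : (parent ^ suc m) c ≡ c) (cC : VertexOf H C c) where
        open Iterate.Periodic parent c m period

        orbitEdges : Subset nE
        orbitEdges = select λ e → (e ∈? C) ×-dec orbit? _≟_ (head e)

        orbitEdges⊆C : orbitEdges ⊆ C
        orbitEdges⊆C = proj₁ ∘ Equivalence.to (∈-select _)

        orbitEdges⊆F : orbitEdges ⊆ F
        orbitEdges⊆F = C⊆F ∘ orbitEdges⊆C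

        head-orbit : e ∈ orbitEdges → Orbit (head e)
        head-orbit = proj₂ ∘ Equivalence.to (∈-select _)

        orbit-inEdge : Orbit v → HasInEdge orbitEdges v
        orbit-inEdge ov = in-orbitEdges (in-edges (orbit-⊆ (VertexOf H C) parent-vertex cC ov))
          where
          in-orbitEdges : HasInEdge C _ → HasInEdge orbitEdges _
          in-orbitEdges (e , e∈C , h≡v) = e , Equivalence.from (∈-select _) (e∈C , subst Orbit (sym h≡v) ov) , h≡v

        vertex⇒orbit : VertexOf H orbitEdges v → Orbit v
        vertex⇒orbit (e , e∈D , i) with incident⇒tail⊎head (orbitEdges⊆F e∈D) i
        ... | inj₁ v≡t = subst Orbit (trans (parent-head (orbitEdges⊆F e∈D)) (sym v≡t)) (orbit-step (head-orbit e∈D))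
        ... | inj₂ v≡h = subst Orbit (sym v≡h) (head-orbit e∈D)

        walk-to-parent : Orbit v → Walk H orbitEdges v (parent v)
        walk-to-parent ov = edge (orbit-inEdge ov)
          where
          edge : HasInEdge orbitEdges _ → Walk H orbitEdges _ _
          edge (e , e∈D , h≡v) = step e e∈D (joins-parent-of-head (orbitEdges⊆F e∈D) h≡v) here

        walk-from-c : ∀ k → Walk H orbitEdges c ((parent ^ k) c)
        walk-from-c zero    = here
        walk-from-c (suc k) = walk-from-c k ++ʷ walk-to-parent (k , refl)

        orbitEdges-connected : Connected H orbitEdges
        orbitEdges-connected u v uD vD = reverseʷ (walk-from (vertex⇒orbit uD)) ++ʷ walk-from (vertex⇒orbit vD)
          where
          walk-from : ∀ {w} → Orbit w → Walk H orbitEdges c w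
          walk-from (k , refl) = walk-from-c k

        in-edges⇒deg≡2 : ∀ {v y} → HasInEdge orbitEdges v → Orbit y → parent y ≡ v → HasInEdge orbitEdges y →
                         deg H orbitEdges v ≡ 2
        in-edges⇒deg≡2 {v} {y} (a , a∈D , ha≡v) oy py≡v (b , b∈D , hb≡y) =
          only-two⇒deg≡2 a∈D ia b∈D ib a≢b only
          where
          tb≡v : tail b ≡ v
          tb≡v = trans (sym (parent-head (orbitEdges⊆F b∈D))) (trans (cong parent hb≡y) py≡v)
          ia : Incident H a v
          ia = subst (Incident H a) ha≡v (head-incident (orbitEdges⊆F a∈D))
          ib : Incident H b v
          ib = subst (Incident H b) tb≡v (tail-incident (orbitEdges⊆F b∈D))
          a≢b : a ≢ b
          a≢b refl = tail≢head (orbitEdges⊆F b∈D) (trans tb≡v (sym ha≡v))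
          only : ∀ e → e ∈ orbitEdges → Incident H e v → e ≡ a ⊎ e ≡ b
          only e e∈D ie with incident⇒tail⊎head (orbitEdges⊆F e∈D) ie
          ... | inj₂ v≡h =
            inj₁ (head-injective (orbitEdges⊆F e∈D) (orbitEdges⊆F a∈D) (trans (sym v≡h) (sym ha≡v)))
          ... | inj₁ v≡t = inj₂ (head-injective (orbitEdges⊆F e∈D) (orbitEdges⊆F b∈D) (trans
                (orbit-injective (head-orbit e∈D) oy
                  (trans (parent-head (orbitEdges⊆F e∈D)) (trans (sym v≡t) (sym py≡v))))
                (sym hb≡y)))

        orbitEdges-2-regular : ∀ v → VertexOf H orbitEdges v → deg H orbitEdges v ≡ 2
        orbitEdges-2-regular v vD = at-predecessor (orbit-pred (vertex⇒orbit vD))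
          where
          at-predecessor : ∃[ y ] (Orbit y × parent y ≡ v) → deg H orbitEdges v ≡ 2
          at-predecessor (y , oy , py≡v) = in-edges⇒deg≡2 (orbit-inEdge (vertex⇒orbit vD)) oy py≡v (orbit-inEdge oy)

        orbitEdges-cycle : IsCycle H orbitEdges
        orbitEdges-cycle = Product.map₂ proj₁ (orbit-inEdge orbit-start) , orbitEdges-connected , orbitEdges-2-regular

      has-cycle : Nonempty C → ∃[ D ] (D ⊆ C × IsCycle H D)
      has-cycle (e₀ , e₀∈C) with eventually-periodic parent (head e₀)
      ... | i , m , period = orbitEdges , orbitEdges⊆C , orbitEdges-cycle
        where
        open OrbitCycle ((parent ^ i) (head e₀)) m period
          (^-preserves (VertexOf H C) parent-vertex i (e₀ , e₀∈C , head-incident (C⊆F e₀∈C)))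

  is-TU : IsTU H F
  is-TU C (C⊆F , nonempty , connected , _) with any? (λ v → vertexOf? C v ×-dec ¬? (hasInEdge? C v))
  ... | yes (r , rC , no-in) = inj₁ (connected , λ D D⊆C → source⇒acyclic C⊆F connected rC no-in D⊆C)
  ... | no no-source = inj₂ (connected , unicyclic (has-cycle C⊆F connected in-edges nonempty))
    where
    in-edges : ∀ {v} → VertexOf H C v → HasInEdge C v
    in-edges {v} vC with hasInEdge? C v
    ... | yes in-edge  = in-edge
    ... | no ¬in-edge = contradiction (v , vC , ¬in-edge) no-source
    unicyclic : ∃[ D ] (D ⊆ C × IsCycle H D) →
                ∃[ D ] (D ⊆ C × IsCycle H D × (∀ D′ → D′ ⊆ C → IsCycle H D′ → D′ ≡ D))
    unicyclic (D , D⊆C , cycle) =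
      D , D⊆C , cycle , λ D′ D′⊆C cycle′ → unique-cycle C⊆F connected D⊆C cycle D′⊆C cycle′

-- Heads from a matching of the subdivision graph

module Subdivision (G : Graph) where
  open Multigraph (Graph.mg G)

  endpoint : Fin (nE + nE) → Fin nV
  endpoint f = [ proj₁ ∘ ends , proj₂ ∘ ends ] (splitAt nE f)

  SG-ends : ∀ f → Multigraph.ends (SG G) f ≡ (nV ↑ʳ eOf G f , endpoint f ↑ˡ nE)
  SG-ends f with splitAt nE f
  ... | inj₁ _ = refl
  ... | inj₂ _ = refl

  endpoint-incident : ∀ f → Incident (Graph.mg G) (eOf G f) (endpoint f)
  endpoint-incident f with splitAt nE f
  ... | inj₁ _ = inj₁ refl
  ... | inj₂ _ = inj₂ refl

  module _ {M : Subset (nE + nE)} (matching : IsMatching (SG G) M) where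

    endpoint-injective : ∀ {f f′} → f ∈ M → f′ ∈ M → endpoint f ≡ endpoint f′ → f ≡ f′
    endpoint-injective {f} {f′} f∈M f′∈M eq with f ≟ f′
    ... | yes f≡f′ = f≡f′
    ... | no f≢f′  = contradiction
      (inj₂ (trans (cong proj₂ (SG-ends f′)) (cong (_↑ˡ nE) (sym eq))))
      (matching f f′ f∈M f′∈M f≢f′ (endpoint f ↑ˡ nE) (inj₂ (cong proj₂ (SG-ends f))))

    module _ {F : Subset nE} (image : IsImage G M F) where

      -- The head of e ∈ F is the endpoint of the matching edge at the subdivision vertex e (junk off F).
      head : Fin nE → Fin nV
      head e with e ∈? F
      ... | yes e∈F = endpoint (proj₁ (proj₁ (image e) e∈F))
      ... | no _    = proj₁ (ends e)

      head-matched : ∀ {e} → e ∈ F → ∃[ f ] (f ∈ M × eOf G f ≡ e × endpoint f ≡ head e)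
      head-matched {e} e∈F with e ∈? F
      ... | yes e∈F′ = let f , f∈M , e[f]≡e = proj₁ (image e) e∈F′ in f , f∈M , e[f]≡e , refl
      ... | no e∉F   = contradiction e∈F e∉F

      head-incident : ∀ {e} → e ∈ F → Incident (Graph.mg G) e (head e)
      head-incident e∈F with head-matched e∈F
      ... | f , _ , e[f]≡e , endpoint≡head = subst₂ (Incident (Graph.mg G)) e[f]≡e endpoint≡head (endpoint-incident f)

      head-injective : ∀ {e e′} → e ∈ F → e′ ∈ F → head e ≡ head e′ → e ≡ e′
      head-injective {e} {e′} e∈F e′∈F h≡h′ with head-matched e∈F | head-matched e′∈F
      ... | f , f∈M , e[f]≡e , p≡h | f′ , f′∈M , e[f′]≡e′ , p′≡h′ = begin
        e        ≡⟨ e[f]≡e ⟨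
        eOf G f  ≡⟨ cong (eOf G) (endpoint-injective f∈M f′∈M (trans p≡h (trans h≡h′ (sym p′≡h′)))) ⟩
        eOf G f′ ≡⟨ e[f′]≡e′ ⟩
        e′       ∎
        where open ≡-Reasoning

lemma2p4 : (G : Graph) (r : ℕ) (M : Subset (Multigraph.nE (SG G))) →
           IsRMatching (SG G) r M →
           (F : Subset (Multigraph.nE (Graph.mg G))) → IsImage G M F →
           IsTU (Graph.mg G) F
lemma2p4 G _ _ (matching , _) F image =
  InjectiveHeads.is-TU (Graph.mg G) (Graph.loopless G) F
    (head matching image) (head-incident matching image) (head-injective matching image)
  where open Subdivision G
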